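{- In the formal power series ring $\mathbb{Q}[[x]]$, let $\beta=\sum_{k=0}^{\infty}C_kx^{k+1}=\frac{1-\sqrt{1-4x}}{2}$, where $C_k=\frac{1}{k+1}\binom{2k}{k}$, so that $\beta(1-\beta)=x$. Then \[ \sum_{k=1}^{\infty}\binom{2k}{k}H_k^{(2)}x^k=\frac{2{\rm Li}_2(\beta)+{\rm Li}_1(\beta)^2}{1-2\beta}, \] and \[ \sum_{k=1}^{\infty}C_kH_k^{(2)}x^{k+1}=2\beta\,{\rm Li}_2(\beta)-(1-\beta){\rm Li}_1(\beta)^2. \]
   Context: $H_k^{(d)}=\sum_{j=1}^{k}1/j^d$ denotes the generalized harmonic number. For an integer $d$, ${\rm Li}_d(t)=\sum_{k=1}^{\infty}t^k/k^d$ is the polylogarithm viewed as a formal power series; ${\rm Li}_d(\beta)$ denotes its composition with $\beta\in x\mathbb{Q}[[x]]$. -}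

module Defs where

open import Data.Nat as ℕ using (ℕ; zero; suc; _∸_; _^_)
open import Data.Nat.Combinatorics using (_C_)
open import Data.Integer using (+_)
open import Data.Rational using (ℚ; 0ℚ; 1ℚ; _+_; _*_; _-_; _/_)
open import Data.Product using (_×_)
open import Relation.Binary.PropositionalEquality using (_≡_)

PS : Set
PS = ℕ → ℚ

ℕ→ℚ : ℕ → ℚ
ℕ→ℚ n = (+ n) / 1

sumTo : ℕ → (ℕ → ℚ) → ℚ
sumTo zero    f = f 0
sumTo (suc n) f = sumTo n f + f (suc n)

sum1To : ℕ → (ℕ → ℚ) → ℚ
sum1To zero    f = 0ℚ
sum1To (suc n) f = sum1To n f + f (suc n)

cst : ℚ → PS
cst c zero    = c
cst c (suc _) = 0ℚ

_⊕_ : PS → PS → PS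
(f ⊕ g) n = f n + g n

_⊖_ : PS → PS → PS
(f ⊖ g) n = f n - g n

_·_ : ℚ → PS → PS
(c · f) n = c * f n

_⊛_ : PS → PS → PS
(f ⊛ g) n = sumTo n (λ i → f i * g (n ∸ i))

infixl 6 _⊕_ _⊖_
infixl 7 _⊛_ _·_

pow : PS → ℕ → PS
pow f zero    = cst 1ℚ
pow f (suc k) = f ⊛ pow f k

-- 1 / k^d for k ≥ 1, written with k = suc m
invPow : ℕ → ℕ → ℚ
invPow d m = _/_ (+ 1) (suc m ^ d) {{ℕ.m^n≢0 (suc m) d}}
  where import Data.Nat.Properties as ℕ

H : ℕ → ℕ → ℚ
H d k = sum1To k (λ j → recip j)
  where
  recip : ℕ → ℚ
  recip zero    = 0ℚ   -- never used (j ≥ 1)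
  recip (suc m) = invPow d m

-- Li_d(β) = Σ_{k≥1} β^k / k^d, composed with a series β with zero constant term;
-- the coefficient of x^n only involves k ≤ n since β^k = O(x^k).
Li : ℕ → PS → PS
Li d β n = sum1To n (λ k → recip k * pow β k n)
  where
  recip : ℕ → ℚ
  recip zero    = 0ℚ
  recip (suc m) = invPow d m

catalan : ℕ → ℚ
catalan k = (+ ((2 ℕ.* k) C k)) / suc k

β : PS
β zero    = 0ℚ
β (suc k) = catalan k

-- Σ_{k≥1} binom(2k,k) H_k^{(2)} x^k  (the k = 0 term vanishes since H_0 = 0)
lhs₁ : PS
lhs₁ k = ℕ→ℚ ((2 ℕ.* k) C k) * H 2 k

lhs₂ : PS
lhs₂ zero    = 0ℚ
lhs₂ (suc k) = catalan k * H 2 k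

oneMinus2β : PS
oneMinus2β = cst 1ℚ ⊖ ℕ→ℚ 2 · β

rhs₁num : PS
rhs₁num = ℕ→ℚ 2 · Li 2 β ⊕ Li 1 β ⊛ Li 1 β

rhs₂ : PS
rhs₂ = ℕ→ℚ 2 · (β ⊛ Li 2 β) ⊖ (cst 1ℚ ⊖ β) ⊛ (Li 1 β ⊛ Li 1 β)

{-# OPTIONS --safe #-}
-- Write θ = x d/dx.  Two series with the same constant term and the same image under θ are equal,
-- and the same holds for D = (1 − 4x)θ − 2x, which acts on coefficients as a first-order recurrence.
-- With B = Σ binom(2n,n) xⁿ, the recurrence of the central binomial coefficients reads D B = 0,
-- and θβ = xB.  Comparing images under D and θ gives B(1 − 2β) = 1, then β(1 − β) = x.
-- Differentiating the polylogarithms termwise gives β θLi_{d+1}(β) = Li_d(β) θβ, hence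
-- θLi₁(β) = βB and θLi₂(β) = (1 − β) Li₁(β) B.  Since H_n^(2) − H_{n−1}^(2) = 1/n², D maps
-- Σ binom(2n,n) H_n^(2) xⁿ to Σ binom(2n,n) xⁿ/n = 2 Li₁(β); so θ of both sides of the first
-- identity equals 2 B Li₁(β), and θ of both sides of the second equals x B (2 Li₂(β) + Li₁(β)²).
module Submission where

open import Data.Nat as ℕ using (ℕ; zero; suc; _∸_; _≤_; _<_; z≤n; s≤s; _!)
import Data.Nat.Properties as ℕ
open import Data.Nat.Properties using (_!*_!≢0)
open import Data.Nat.Combinatorics using (_C_; nCk≡n!/k![n-k]!; k![n∸k]!∣n!)
open import Data.Nat.DivMod using (m/n*n≡m)
import Data.Nat.Tactic.RingSolver as ℕ-Solver
open import Data.Integer as ℤ using (+_)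
import Data.Integer.Properties as ℤ
open import Data.Integer.Tactic.RingSolver using (solve-∀)
open import Data.Rational as ℚ using (ℚ; 0ℚ; 1ℚ; _+_; _*_; _-_; -_; _/_; toℚᵘ)
open import Data.Rational.Properties
open import Data.Rational.Solver using (module +-*-Solver)
import Data.Rational.Unnormalised as ℚᵘ
import Data.Rational.Unnormalised.Properties as ℚᵘ
open import Data.Product using (_×_; _,_)
open import Data.Sum using (inj₁; inj₂)
open import Data.Maybe using (Maybe; just; nothing)
open import Function using (_∘_)
open import Level using (0ℓ)
open import Relation.Nullary using (yes; no)
open import Relation.Binary.Bundles using (Setoid)
open import Relation.Binary.PropositionalEquality
  using (_≡_; refl; sym; trans; cong; cong₂; subst; module ≡-Reasoning)
import Relation.Binary.Reasoning.Setoid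
open import Algebra.Bundles using (CommutativeRing; CommutativeMonoid)
open import Algebra.Structures using (IsAbelianGroup; IsCommutativeRing)
import Algebra.Consequences.Setoid as Consequences
open import Algebra.Properties.Group +-0-group using (∙-cancelʳ)
import Algebra.Properties.CommutativeSemigroup as CommutativeSemigroupProperties
open CommutativeSemigroupProperties (CommutativeMonoid.commutativeSemigroup +-0-commutativeMonoid)
  using (interchange)
open CommutativeSemigroupProperties (CommutativeMonoid.commutativeSemigroup *-1-commutativeMonoid)
  using (x∙yz≈y∙xz)
import Algebra.Solver.Ring
open import Algebra.Solver.Ring.AlmostCommutativeRing
  using (fromCommutativeRing; _-Raw-AlmostCommutative⟶_)
open import Defs

toℚᵘ-/ : ∀ i n .{{_ : ℕ.NonZero n}} → toℚᵘ (i / n) ℚᵘ.≃ i ℚᵘ./ n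
toℚᵘ-/ i (suc n) = toℚᵘ-fromℚᵘ (i ℚᵘ./ suc n)

ℕ→ℚ-+ : ∀ m n → ℕ→ℚ (m ℕ.+ n) ≡ ℕ→ℚ m + ℕ→ℚ n
ℕ→ℚ-+ m n = toℚᵘ-injective (begin
  toℚᵘ (ℕ→ℚ (m ℕ.+ n))            ≈⟨ toℚᵘ-/ (+ (m ℕ.+ n)) 1 ⟩
  + (m ℕ.+ n) ℚᵘ./ 1              ≈⟨ ℚᵘ.*≡* (trans (cong (ℤ._* + 1) (ℤ.pos-+ m n)) (rearrange (+ m) (+ n))) ⟩
  (+ m ℚᵘ./ 1) ℚᵘ.+ (+ n ℚᵘ./ 1)  ≈⟨ ℚᵘ.+-cong (toℚᵘ-/ (+ m) 1) (toℚᵘ-/ (+ n) 1) ⟨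
  toℚᵘ (ℕ→ℚ m) ℚᵘ.+ toℚᵘ (ℕ→ℚ n)  ≈⟨ toℚᵘ-homo-+ (ℕ→ℚ m) (ℕ→ℚ n) ⟨
  toℚᵘ (ℕ→ℚ m + ℕ→ℚ n)            ∎)
  where
  open ℚᵘ.≃-Reasoning
  rearrange : ∀ i j → (i ℤ.+ j) ℤ.* + 1 ≡ (i ℤ.* + 1 ℤ.+ j ℤ.* + 1) ℤ.* + 1
  rearrange = solve-∀

ℕ→ℚ-* : ∀ m n → ℕ→ℚ (m ℕ.* n) ≡ ℕ→ℚ m * ℕ→ℚ n
ℕ→ℚ-* m n = toℚᵘ-injective (begin
  toℚᵘ (ℕ→ℚ (m ℕ.* n))            ≈⟨ toℚᵘ-/ (+ (m ℕ.* n)) 1 ⟩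
  + (m ℕ.* n) ℚᵘ./ 1              ≈⟨ ℚᵘ.*≡* (cong (ℤ._* + 1) (ℤ.pos-* m n)) ⟩
  (+ m ℚᵘ./ 1) ℚᵘ.* (+ n ℚᵘ./ 1)  ≈⟨ ℚᵘ.*-cong (toℚᵘ-/ (+ m) 1) (toℚᵘ-/ (+ n) 1) ⟨
  toℚᵘ (ℕ→ℚ m) ℚᵘ.* toℚᵘ (ℕ→ℚ n)  ≈⟨ toℚᵘ-homo-* (ℕ→ℚ m) (ℕ→ℚ n) ⟨
  toℚᵘ (ℕ→ℚ m * ℕ→ℚ n)            ∎)
  where open ℚᵘ.≃-Reasoning

ℕ→ℚ-*-/ : ∀ i k n .{{_ : ℕ.NonZero n}} .{{_ : ℕ.NonZero (suc k ℕ.* n)}} →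
          ℕ→ℚ (suc k) * (i / (suc k ℕ.* n)) ≡ i / n
ℕ→ℚ-*-/ i k (suc n) = toℚᵘ-injective (begin
  toℚᵘ (ℕ→ℚ (suc k) * (i / (suc k ℕ.* suc n)))
    ≈⟨ toℚᵘ-homo-* (ℕ→ℚ (suc k)) _ ⟩
  toℚᵘ (ℕ→ℚ (suc k)) ℚᵘ.* toℚᵘ (i / (suc k ℕ.* suc n))
    ≈⟨ ℚᵘ.*-cong (toℚᵘ-/ (+ suc k) 1) (toℚᵘ-/ i (suc k ℕ.* suc n)) ⟩
  (+ suc k ℚᵘ./ 1) ℚᵘ.* (i ℚᵘ./ (suc k ℕ.* suc n))
    ≈⟨ ℚᵘ.*≡* (trans (rearrange (+ suc k) i (+ suc n)) (cong (i ℤ.*_) (sym denominator))) ⟩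
  i ℚᵘ./ suc n
    ≈⟨ toℚᵘ-/ i (suc n) ⟨
  toℚᵘ (i / suc n) ∎)
  where
  open ℚᵘ.≃-Reasoning
  rearrange : ∀ a i b → (a ℤ.* i) ℤ.* b ≡ i ℤ.* (+ 1 ℤ.* (a ℤ.* b))
  rearrange = solve-∀
  denominator : + (1 ℕ.* (suc k ℕ.* suc n)) ≡ + 1 ℤ.* (+ suc k ℤ.* + suc n)
  denominator = trans (ℤ.pos-* 1 _) (cong (+ 1 ℤ.*_) (ℤ.pos-* (suc k) (suc n)))

ℕ→ℚ-*-invPow : ∀ d m → ℕ→ℚ (suc m) * invPow (suc d) m ≡ invPow d m
ℕ→ℚ-*-invPow d m = ℕ→ℚ-*-/ (+ 1) m (suc m ℕ.^ d) {{ℕ.m^n≢0 (suc m) d}} {{ℕ.m^n≢0 (suc m) (suc d)}}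

ℕ→ℚ-*-catalan : ∀ k → ℕ→ℚ (suc k) * catalan k ≡ ℕ→ℚ ((2 ℕ.* k) C k)
ℕ→ℚ-*-catalan k = trans (cong (ℕ→ℚ (suc k) *_) denominator) (ℕ→ℚ-*-/ (+ c) k 1)
  where
  c = (2 ℕ.* k) C k
  denominator : catalan k ≡ + c / (suc k ℕ.* 1)
  denominator = /-cong {+ c} {suc k} {+ c} {suc k ℕ.* 1} refl (sym (ℕ.*-identityʳ (suc k)))

ℕ→ℚ-suc-cancelˡ : ∀ m {p q} → ℕ→ℚ (suc m) * p ≡ ℕ→ℚ (suc m) * q → p ≡ q
ℕ→ℚ-suc-cancelˡ m {p} {q} eq = begin
  p                               ≡⟨ *-identityˡ p ⟨
  1ℚ * p                          ≡⟨ cong (_* p) inverse ⟨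
  invPow 1 m * ℕ→ℚ (suc m) * p    ≡⟨ *-assoc (invPow 1 m) _ p ⟩
  invPow 1 m * (ℕ→ℚ (suc m) * p)  ≡⟨ cong (invPow 1 m *_) eq ⟩
  invPow 1 m * (ℕ→ℚ (suc m) * q)  ≡⟨ *-assoc (invPow 1 m) _ q ⟨
  invPow 1 m * ℕ→ℚ (suc m) * q    ≡⟨ cong (_* q) inverse ⟩
  1ℚ * q                          ≡⟨ *-identityˡ q ⟩
  q                               ∎
  where
  open ≡-Reasoning
  inverse : invPow 1 m * ℕ→ℚ (suc m) ≡ 1ℚ
  inverse = trans (*-comm (invPow 1 m) _) (ℕ→ℚ-*-invPow 0 m)

2ℚ : ℚ
2ℚ = ℕ→ℚ 2

4ℚ : ℚ
4ℚ = ℕ→ℚ 4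

-- Finite sums

sumTo-cong : ∀ n {f g : ℕ → ℚ} → (∀ i → i ≤ n → f i ≡ g i) → sumTo n f ≡ sumTo n g
sumTo-cong zero    f≗g = f≗g 0 z≤n
sumTo-cong (suc n) f≗g = cong₂ _+_ (sumTo-cong n (λ i i≤n → f≗g i (ℕ.m≤n⇒m≤1+n i≤n))) (f≗g (suc n) ℕ.≤-refl)

sumTo-zero : ∀ n {f : ℕ → ℚ} → (∀ i → i ≤ n → f i ≡ 0ℚ) → sumTo n f ≡ 0ℚ
sumTo-zero n f≗0 = trans (sumTo-cong n f≗0) (sumTo-0ℚ n)
  where
  sumTo-0ℚ : ∀ n → sumTo n (λ _ → 0ℚ) ≡ 0ℚ
  sumTo-0ℚ zero    = refl
  sumTo-0ℚ (suc n) = trans (+-identityʳ _) (sumTo-0ℚ n)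

sumTo-distrib-+ : ∀ n (f g : ℕ → ℚ) → sumTo n (λ i → f i + g i) ≡ sumTo n f + sumTo n g
sumTo-distrib-+ zero    f g = refl
sumTo-distrib-+ (suc n) f g =
  trans (cong (_+ (f (suc n) + g (suc n))) (sumTo-distrib-+ n f g))
        (interchange (sumTo n f) (sumTo n g) (f (suc n)) (g (suc n)))

*-distribˡ-sumTo : ∀ n c (f : ℕ → ℚ) → c * sumTo n f ≡ sumTo n (λ i → c * f i)
*-distribˡ-sumTo zero    c f = refl
*-distribˡ-sumTo (suc n) c f =
  trans (*-distribˡ-+ c (sumTo n f) (f (suc n))) (cong (_+ c * f (suc n)) (*-distribˡ-sumTo n c f))

*-distribʳ-sumTo : ∀ n c (f : ℕ → ℚ) → sumTo n f * c ≡ sumTo n (λ i → f i * c)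
*-distribʳ-sumTo zero    c f = refl
*-distribʳ-sumTo (suc n) c f =
  trans (*-distribʳ-+ c (sumTo n f) (f (suc n))) (cong (_+ f (suc n) * c) (*-distribʳ-sumTo n c f))

sumTo-suc : ∀ n (f : ℕ → ℚ) → sumTo (suc n) f ≡ f 0 + sumTo n (f ∘ suc)
sumTo-suc zero    f = refl
sumTo-suc (suc n) f = trans (cong (_+ f (suc (suc n))) (sumTo-suc n f)) (+-assoc (f 0) _ _)

sumTo-head : ∀ n (f : ℕ → ℚ) → (∀ i → f (suc i) ≡ 0ℚ) → sumTo n f ≡ f 0
sumTo-head zero    f f∘suc≗0 = refl
sumTo-head (suc n) f f∘suc≗0 = trans (cong₂ _+_ (sumTo-head n f f∘suc≗0) (f∘suc≗0 n)) (+-identityʳ (f 0))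

sumTo-reverse : ∀ n (f : ℕ → ℚ) → sumTo n f ≡ sumTo n (λ i → f (n ∸ i))
sumTo-reverse zero    f = refl
sumTo-reverse (suc n) f = begin
  sumTo n f + f (suc n)                  ≡⟨ cong (_+ f (suc n)) (sumTo-reverse n f) ⟩
  sumTo n (λ i → f (n ∸ i)) + f (suc n)  ≡⟨ +-comm _ (f (suc n)) ⟩
  f (suc n) + sumTo n (λ i → f (n ∸ i))  ≡⟨ sumTo-suc n (λ i → f (suc n ∸ i)) ⟨
  sumTo (suc n) (λ i → f (suc n ∸ i))    ∎
  where open ≡-Reasoning

sumTo-triangle : ∀ n (F : ℕ → ℕ → ℚ) →
                 sumTo n (λ i → sumTo i (F i)) ≡ sumTo n (λ j → sumTo (n ∸ j) (λ k → F (j ℕ.+ k) j))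
sumTo-triangle zero    F = refl
sumTo-triangle (suc n) F = begin
  sumTo n (λ i → sumTo i (F i)) + sumTo (suc n) (F (suc n))
    ≡⟨ cong (_+ sumTo (suc n) (F (suc n))) (sumTo-triangle n F) ⟩
  sumTo n (column n) + (sumTo n (F (suc n)) + F (suc n) (suc n))
    ≡⟨ +-assoc (sumTo n (column n)) _ _ ⟨
  sumTo n (column n) + sumTo n (F (suc n)) + F (suc n) (suc n)
    ≡⟨ cong₂ _+_ (sumTo-distrib-+ n (column n) (F (suc n))) (cong (λ m → F m (suc n)) (ℕ.+-identityʳ (suc n))) ⟨
  sumTo n (λ j → column n j + F (suc n) j) + F (suc n ℕ.+ 0) (suc n)
    ≡⟨ cong₂ _+_ (sumTo-cong n extend) (cong (λ m → sumTo m (λ k → F (suc n ℕ.+ k) (suc n))) (ℕ.n∸n≡0 n)) ⟨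
  sumTo n (column (suc n)) + column (suc n) (suc n) ∎
  where
  open ≡-Reasoning
  column : ℕ → ℕ → ℚ
  column m j = sumTo (m ∸ j) (λ k → F (j ℕ.+ k) j)
  extend : ∀ j → j ≤ n → column (suc n) j ≡ column n j + F (suc n) j
  extend j j≤n = begin
    column (suc n) j                      ≡⟨ cong (λ m → sumTo m (λ k → F (j ℕ.+ k) j)) (ℕ.+-∸-assoc 1 j≤n) ⟩
    column n j + F (j ℕ.+ suc (n ∸ j)) j  ≡⟨ cong (λ m → column n j + F m j) j+[1+n-j]≡1+n ⟩
    column n j + F (suc n) j              ∎
    where
    j+[1+n-j]≡1+n : j ℕ.+ suc (n ∸ j) ≡ suc n
    j+[1+n-j]≡1+n = trans (cong (j ℕ.+_) (sym (ℕ.+-∸-assoc 1 j≤n))) (ℕ.m+[n∸m]≡n (ℕ.m≤n⇒m≤1+n j≤n))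

sum1To-extend : ∀ j M {F : ℕ → ℚ} → j ≤ M → (∀ m → j ≤ m → F (suc m) ≡ 0ℚ) → sum1To M F ≡ sum1To j F
sum1To-extend j zero    z≤n   F-vanishes = refl
sum1To-extend j (suc M) j≤1+M F-vanishes with ℕ.m≤n⇒m<n∨m≡n j≤1+M
... | inj₁ (s≤s j≤M) = trans (cong₂ _+_ (sum1To-extend j M j≤M F-vanishes) (F-vanishes M j≤M)) (+-identityʳ _)
... | inj₂ refl      = refl

-- The commutative ring of formal power series

infix 4 _≈_
_≈_ : PS → PS → Set
f ≈ g = ∀ n → f n ≡ g n

0ₛ : PS
0ₛ _ = 0ℚ

infix 8 ⊝_
⊝_ : PS → PS
(⊝ f) n = - f n

⊛-cong : ∀ {f f′ g g′} → f ≈ f′ → g ≈ g′ → f ⊛ g ≈ f′ ⊛ g′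
⊛-cong f≈f′ g≈g′ n = sumTo-cong n (λ i _ → cong₂ _*_ (f≈f′ i) (g≈g′ (n ∸ i)))

⊛-comm : ∀ f g → f ⊛ g ≈ g ⊛ f
⊛-comm f g n = trans (sumTo-reverse n (λ i → f i * g (n ∸ i))) (sumTo-cong n swap)
  where
  swap : ∀ i → i ≤ n → f (n ∸ i) * g (n ∸ (n ∸ i)) ≡ g i * f (n ∸ i)
  swap i i≤n = trans (cong (λ j → f (n ∸ i) * g j) (ℕ.m∸[m∸n]≡n i≤n)) (*-comm (f (n ∸ i)) (g i))

⊛-assoc : ∀ f g h → (f ⊛ g) ⊛ h ≈ f ⊛ (g ⊛ h)
⊛-assoc f g h n = begin
  sumTo n (λ i → sumTo i (λ j → f j * g (i ∸ j)) * h (n ∸ i))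
    ≡⟨ sumTo-cong n (λ i _ → *-distribʳ-sumTo i (h (n ∸ i)) (λ j → f j * g (i ∸ j))) ⟩
  sumTo n (λ i → sumTo i (λ j → f j * g (i ∸ j) * h (n ∸ i)))
    ≡⟨ sumTo-triangle n (λ i j → f j * g (i ∸ j) * h (n ∸ i)) ⟩
  sumTo n (λ j → sumTo (n ∸ j) (λ k → f j * g ((j ℕ.+ k) ∸ j) * h (n ∸ (j ℕ.+ k))))
    ≡⟨ sumTo-cong n (λ j _ → sumTo-cong (n ∸ j) (λ k _ → reindex j k)) ⟩
  sumTo n (λ j → sumTo (n ∸ j) (λ k → f j * (g k * h (n ∸ j ∸ k))))
    ≡⟨ sumTo-cong n (λ j _ → *-distribˡ-sumTo (n ∸ j) (f j) (λ k → g k * h (n ∸ j ∸ k))) ⟨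
  sumTo n (λ j → f j * sumTo (n ∸ j) (λ k → g k * h (n ∸ j ∸ k))) ∎
  where
  open ≡-Reasoning
  reindex : ∀ j k → f j * g ((j ℕ.+ k) ∸ j) * h (n ∸ (j ℕ.+ k)) ≡ f j * (g k * h (n ∸ j ∸ k))
  reindex j k = trans (cong₂ (λ a b → f j * g a * h b) (ℕ.m+n∸m≡n j k) (sym (ℕ.∸-+-assoc n j k)))
                      (*-assoc (f j) (g k) (h (n ∸ j ∸ k)))

cst-⊛ : ∀ c g → cst c ⊛ g ≈ c · g
cst-⊛ c g n = sumTo-head n (λ i → cst c i * g (n ∸ i)) (λ i → *-zeroˡ (g (n ∸ suc i)))

⊛-identityˡ : ∀ g → cst 1ℚ ⊛ g ≈ g
⊛-identityˡ g n = trans (cst-⊛ 1ℚ g n) (*-identityˡ (g n))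

⊛-distribˡ-⊕ : ∀ f g h → f ⊛ (g ⊕ h) ≈ f ⊛ g ⊕ f ⊛ h
⊛-distribˡ-⊕ f g h n =
  trans (sumTo-cong n (λ i _ → *-distribˡ-+ (f i) (g (n ∸ i)) (h (n ∸ i))))
        (sumTo-distrib-+ n (λ i → f i * g (n ∸ i)) (λ i → f i * h (n ∸ i)))

⊕-isAbelianGroup : IsAbelianGroup _≈_ _⊕_ 0ₛ ⊝_
⊕-isAbelianGroup = record
  { isGroup = record
    { isMonoid = record
      { isSemigroup = record
        { isMagma = record
          { isEquivalence = record
            { refl  = λ _ → refl
            ; sym   = λ f≈g n → sym (f≈g n)
            ; trans = λ f≈g g≈h n → trans (f≈g n) (g≈h n)
            }
          ; ∙-cong = λ f≈f′ g≈g′ n → cong₂ _+_ (f≈f′ n) (g≈g′ n)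
          }
        ; assoc = λ f g h n → +-assoc (f n) (g n) (h n)
        }
      ; identity = (λ f n → +-identityˡ (f n)) , (λ f n → +-identityʳ (f n))
      }
    ; inverse = (λ f n → +-inverseˡ (f n)) , (λ f n → +-inverseʳ (f n))
    ; ⁻¹-cong = λ f≈g n → cong -_ (f≈g n)
    }
  ; comm = λ f g n → +-comm (f n) (g n)
  }

PS-isCommutativeRing : IsCommutativeRing _≈_ _⊕_ _⊛_ ⊝_ 0ₛ (cst 1ℚ)
PS-isCommutativeRing = record
  { isRing = record
    { +-isAbelianGroup = ⊕-isAbelianGroup
    ; *-cong           = ⊛-cong
    ; *-assoc          = ⊛-assoc
    ; *-identity       = Consequences.comm∧idˡ⇒id setoid ⊛-comm {cst 1ℚ} ⊛-identityˡ
    ; distrib          = Consequences.comm∧distrˡ⇒distr setoid ∙-cong ⊛-comm ⊛-distribˡ-⊕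
    }
  ; *-comm = ⊛-comm
  }
  where open IsAbelianGroup ⊕-isAbelianGroup using (setoid; ∙-cong)

PS-commutativeRing : CommutativeRing 0ℓ 0ℓ
PS-commutativeRing = record { isCommutativeRing = PS-isCommutativeRing }

open CommutativeRing PS-commutativeRing using (setoid; +-cong)
  renaming (refl to ≈-refl; sym to ≈-sym; trans to ≈-trans; -‿cong to ⊝-cong)

cst-+ : ∀ a b → cst (a + b) ≈ cst a ⊕ cst b
cst-+ a b zero    = refl
cst-+ a b (suc n) = sym (+-identityˡ 0ℚ)

cst-* : ∀ a b → cst (a * b) ≈ cst a ⊛ cst b
cst-* a b zero    = refl
cst-* a b (suc n) = sym (trans (cst-⊛ a (cst b) (suc n)) (*-zeroʳ a))

cst-morphism : ℚ.+-*-rawRing -Raw-AlmostCommutative⟶ fromCommutativeRing PS-commutativeRing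
cst-morphism = record
  { ⟦_⟧    = cst
  ; +-homo = cst-+
  ; *-homo = cst-*
  ; -‿homo = λ { a zero → refl ; a (suc n) → refl }
  ; 0-homo = λ { zero → refl ; (suc n) → refl }
  ; 1-homo = λ _ → refl
  }

cst-≟ : ∀ a b → Maybe (cst a ≈ cst b)
cst-≟ a b with a ≟ b
... | yes refl = just (λ _ → refl)
... | no  _    = nothing

module PS-Reasoning where
  open Relation.Binary.Reasoning.Setoid setoid public
  open Algebra.Solver.Ring ℚ.+-*-rawRing (fromCommutativeRing PS-commutativeRing) cst-morphism cst-≟ public
    using (solve; _:=_; con; _:+_; _:*_; _:-_; :-_)

⊕-congˡ : ∀ f {g g′} → g ≈ g′ → f ⊕ g ≈ f ⊕ g′
⊕-congˡ f g≈g′ n = cong₂ _+_ (refl {x = f n}) (g≈g′ n)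

⊕-congʳ : ∀ {f f′} g → f ≈ f′ → f ⊕ g ≈ f′ ⊕ g
⊕-congʳ g f≈f′ n = cong (_+ g n) (f≈f′ n)

⊖-cong : ∀ {f f′ g g′} → f ≈ f′ → g ≈ g′ → f ⊖ g ≈ f′ ⊖ g′
⊖-cong f≈f′ g≈g′ n = cong₂ _-_ (f≈f′ n) (g≈g′ n)

⊛-congˡ : ∀ f {g g′} → g ≈ g′ → f ⊛ g ≈ f ⊛ g′
⊛-congˡ f = ⊛-cong {f} (λ _ → refl)

⊛-congʳ : ∀ {f f′} g → f ≈ f′ → f ⊛ g ≈ f′ ⊛ g
⊛-congʳ g f≈f′ = ⊛-cong {g = g} f≈f′ (λ _ → refl)

-- The Euler derivation θ = x d/dx

θ : PS → PS
θ f n = ℕ→ℚ n * f n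

X : PS
X zero    = 0ℚ
X (suc n) = cst 1ℚ n

θ-⊕ : ∀ f g → θ (f ⊕ g) ≈ θ f ⊕ θ g
θ-⊕ f g n = *-distribˡ-+ (ℕ→ℚ n) (f n) (g n)

θ-⊖ : ∀ f g → θ (f ⊖ g) ≈ θ f ⊖ θ g
θ-⊖ f g n = distrib (ℕ→ℚ n) (f n) (g n)
  where
  open +-*-Solver
  distrib : ∀ x a b → x * (a - b) ≡ x * a - x * b
  distrib = solve 3 (λ x a b → x :* (a :- b) := x :* a :- x :* b) refl

θ-· : ∀ c f → θ (c · f) ≈ c · θ f
θ-· c f n = x∙yz≈y∙xz (ℕ→ℚ n) c (f n)

θ-cst : ∀ c → θ (cst c) ≈ cst 0ℚ
θ-cst c zero    = *-zeroˡ c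
θ-cst c (suc n) = *-zeroʳ (ℕ→ℚ (suc n))

θ-X : θ X ≈ X
θ-X zero          = refl
θ-X (suc zero)    = refl
θ-X (suc (suc n)) = *-zeroʳ (ℕ→ℚ (suc (suc n)))

θ-⊛ : ∀ f g → θ (f ⊛ g) ≈ θ f ⊛ g ⊕ f ⊛ θ g
θ-⊛ f g n = begin
  ℕ→ℚ n * sumTo n (λ i → f i * g (n ∸ i))
    ≡⟨ *-distribˡ-sumTo n (ℕ→ℚ n) (λ i → f i * g (n ∸ i)) ⟩
  sumTo n (λ i → ℕ→ℚ n * (f i * g (n ∸ i)))
    ≡⟨ sumTo-cong n leibniz ⟩
  sumTo n (λ i → ℕ→ℚ i * f i * g (n ∸ i) + f i * (ℕ→ℚ (n ∸ i) * g (n ∸ i)))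
    ≡⟨ sumTo-distrib-+ n (λ i → ℕ→ℚ i * f i * g (n ∸ i)) (λ i → f i * (ℕ→ℚ (n ∸ i) * g (n ∸ i))) ⟩
  (θ f ⊛ g ⊕ f ⊛ θ g) n ∎
  where
  open ≡-Reasoning
  distrib : ∀ a b x y → (a + b) * (x * y) ≡ a * x * y + x * (b * y)
  distrib = solve 4 (λ a b x y → (a :+ b) :* (x :* y) := a :* x :* y :+ x :* (b :* y)) refl
    where open +-*-Solver
  leibniz : ∀ i → i ≤ n →
            ℕ→ℚ n * (f i * g (n ∸ i)) ≡ ℕ→ℚ i * f i * g (n ∸ i) + f i * (ℕ→ℚ (n ∸ i) * g (n ∸ i))
  leibniz i i≤n =
    trans (cong (_* (f i * g (n ∸ i))) n≡i+[n-i]) (distrib (ℕ→ℚ i) (ℕ→ℚ (n ∸ i)) (f i) (g (n ∸ i)))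
    where
    n≡i+[n-i] : ℕ→ℚ n ≡ ℕ→ℚ i + ℕ→ℚ (n ∸ i)
    n≡i+[n-i] = trans (cong ℕ→ℚ (sym (ℕ.m+[n∸m]≡n i≤n))) (ℕ→ℚ-+ i (n ∸ i))

θ-⊛₃ : ∀ f g h → θ (f ⊛ g ⊛ h) ≈ θ f ⊛ g ⊛ h ⊕ f ⊛ θ g ⊛ h ⊕ f ⊛ g ⊛ θ h
θ-⊛₃ f g h = begin
  θ (f ⊛ g ⊛ h)
    ≈⟨ θ-⊛ (f ⊛ g) h ⟩
  θ (f ⊛ g) ⊛ h ⊕ f ⊛ g ⊛ θ h
    ≈⟨ ⊕-congʳ (f ⊛ g ⊛ θ h) (⊛-congʳ h (θ-⊛ f g)) ⟩
  (θ f ⊛ g ⊕ f ⊛ θ g) ⊛ h ⊕ f ⊛ g ⊛ θ h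
    ≈⟨ solve 6 (λ f g h f′ g′ h′ → (f′ :* g :+ f :* g′) :* h :+ f :* g :* h′ := f′ :* g :* h :+ f :* g′ :* h :+ f :* g :* h′)
               ≈-refl f g h (θ f) (θ g) (θ h) ⟩
  θ f ⊛ g ⊛ h ⊕ f ⊛ θ g ⊛ h ⊕ f ⊛ g ⊛ θ h ∎
  where open PS-Reasoning

θ-cst-⊛ : ∀ c f → θ (cst c ⊛ f) ≈ cst c ⊛ θ f
θ-cst-⊛ c f = begin
  θ (cst c ⊛ f)                ≈⟨ θ-⊛ (cst c) f ⟩
  θ (cst c) ⊛ f ⊕ cst c ⊛ θ f  ≈⟨ ⊕-congʳ (cst c ⊛ θ f) (⊛-congʳ f (θ-cst c)) ⟩
  cst 0ℚ ⊛ f ⊕ cst c ⊛ θ f     ≈⟨ solve 3 (λ f t c → con 0ℚ :* f :+ c :* t := c :* t) ≈-refl f (θ f) (cst c) ⟩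
  cst c ⊛ θ f                  ∎
  where open PS-Reasoning

θ-cst-⊖ : ∀ c f → θ (cst c ⊖ f) ≈ ⊝ θ f
θ-cst-⊖ c f = begin
  θ (cst c ⊖ f)    ≈⟨ θ-⊖ (cst c) f ⟩
  θ (cst c) ⊖ θ f  ≈⟨ ⊕-congʳ (⊝ θ f) (θ-cst c) ⟩
  cst 0ℚ ⊖ θ f     ≈⟨ solve 1 (λ t → con 0ℚ :- t := :- t) ≈-refl (θ f) ⟩
  ⊝ θ f            ∎
  where open PS-Reasoning

θ-pow : ∀ b k → θ (pow b (suc k)) ≈ cst (ℕ→ℚ (suc k)) ⊛ pow b k ⊛ θ b
θ-pow b zero = begin
  θ (b ⊛ cst 1ℚ)                 ≈⟨ θ-⊛ b (cst 1ℚ) ⟩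
  θ b ⊛ cst 1ℚ ⊕ b ⊛ θ (cst 1ℚ)  ≈⟨ ⊕-congˡ (θ b ⊛ cst 1ℚ) (⊛-congˡ b (θ-cst 1ℚ)) ⟩
  θ b ⊛ cst 1ℚ ⊕ b ⊛ cst 0ℚ      ≈⟨ solve 2 (λ b t → t :* con 1ℚ :+ b :* con 0ℚ := con 1ℚ :* con 1ℚ :* t)
                                           ≈-refl b (θ b) ⟩
  cst 1ℚ ⊛ cst 1ℚ ⊛ θ b          ∎
  where open PS-Reasoning
θ-pow b (suc k) = begin
  θ (b ⊛ (b ⊛ bᵏ))
    ≈⟨ θ-⊛ b (b ⊛ bᵏ) ⟩
  θ b ⊛ (b ⊛ bᵏ) ⊕ b ⊛ θ (b ⊛ bᵏ)
    ≈⟨ ⊕-congˡ (θ b ⊛ (b ⊛ bᵏ)) (⊛-congˡ b (θ-pow b k)) ⟩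
  θ b ⊛ (b ⊛ bᵏ) ⊕ b ⊛ (c ⊛ bᵏ ⊛ θ b)
    ≈⟨ solve 4 (λ b t p c → t :* (b :* p) :+ b :* (c :* p :* t) := (con 1ℚ :+ c) :* (b :* p) :* t) ≈-refl b (θ b) bᵏ c ⟩
  (cst 1ℚ ⊕ c) ⊛ (b ⊛ bᵏ) ⊛ θ b
    ≈⟨ ⊛-congʳ (θ b) (⊛-congʳ (b ⊛ bᵏ) (≈-trans 2+k≡1+[1+k] (cst-+ 1ℚ (ℕ→ℚ (suc k))))) ⟨
  cst (ℕ→ℚ (suc (suc k))) ⊛ (b ⊛ bᵏ) ⊛ θ b ∎
  where
  open PS-Reasoning
  bᵏ = pow b k
  c  = cst (ℕ→ℚ (suc k))
  2+k≡1+[1+k] : cst (ℕ→ℚ (suc (suc k))) ≈ cst (1ℚ + ℕ→ℚ (suc k))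
  2+k≡1+[1+k] n = cong (λ a → cst a n) (ℕ→ℚ-+ 1 (suc k))

X-⊛-suc : ∀ g n → (X ⊛ g) (suc n) ≡ g n
X-⊛-suc g n = begin
  (X ⊛ g) (suc n)                  ≡⟨ sumTo-suc n (λ i → X i * g (suc n ∸ i)) ⟩
  0ℚ * g (suc n) + (cst 1ℚ ⊛ g) n  ≡⟨ cong (_+ (cst 1ℚ ⊛ g) n) (*-zeroˡ (g (suc n))) ⟩
  0ℚ + (cst 1ℚ ⊛ g) n              ≡⟨ +-identityˡ _ ⟩
  (cst 1ℚ ⊛ g) n                   ≡⟨ ⊛-identityˡ g n ⟩
  g n                              ∎
  where open ≡-Reasoning

X-cancel : ∀ {f g} → X ⊛ f ≈ X ⊛ g → f ≈ g
X-cancel {f} {g} Xf≈Xg n = trans (sym (X-⊛-suc f n)) (trans (Xf≈Xg (suc n)) (X-⊛-suc g n))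

θ-injective : ∀ {f g} → θ f ≈ θ g → f 0 ≡ g 0 → f ≈ g
θ-injective θf≈θg f₀≡g₀ zero    = f₀≡g₀
θ-injective θf≈θg f₀≡g₀ (suc n) = ℕ→ℚ-suc-cancelˡ n (θf≈θg (suc n))

-- Polylogarithms of a series without constant term

infix 4 _≈[_]_
_≈[_]_ : PS → ℕ → PS → Set
f ≈[ n ] g = ∀ j → j < n → f j ≡ g j

≈[]-setoid : ℕ → Setoid 0ℓ 0ℓ
≈[]-setoid n = record
  { Carrier       = PS
  ; _≈_           = _≈[ n ]_
  ; isEquivalence = record
    { refl  = λ _ _ → refl
    ; sym   = λ f≈g j j<n → sym (f≈g j j<n)
    ; trans = λ f≈g g≈h j j<n → trans (f≈g j j<n) (g≈h j j<n)
    }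
  }

≈[]-refl : ∀ f {n} → f ≈[ n ] f
≈[]-refl f _ _ = refl

≈⇒≈[] : ∀ {f g} n → f ≈ g → f ≈[ n ] g
≈⇒≈[] n f≈g j _ = f≈g j

θ-cong-≈[] : ∀ {f g} n → f ≈[ n ] g → θ f ≈[ n ] θ g
θ-cong-≈[] n f≈g j j<n = cong (ℕ→ℚ j *_) (f≈g j j<n)

⊛-cong-≈[] : ∀ {f f′ g g′} n → f ≈[ n ] f′ → g ≈[ n ] g′ → f ⊛ g ≈[ n ] f′ ⊛ g′
⊛-cong-≈[] n f≈f′ g≈g′ j j<n =
  sumTo-cong j (λ i i≤j → cong₂ _*_ (f≈f′ i (ℕ.≤-<-trans i≤j j<n))
                                     (g≈g′ (j ∸ i) (ℕ.≤-<-trans (ℕ.m∸n≤m j i) j<n)))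

⊛-≈[]-0ₛ : ∀ {f g} p q → f ≈[ p ] 0ₛ → g ≈[ q ] 0ₛ → f ⊛ g ≈[ p ℕ.+ q ] 0ₛ
⊛-≈[]-0ₛ {f} {g} p q f≈0 g≈0 j j<p+q = sumTo-zero j term-vanishes
  where
  term-vanishes : ∀ i → i ≤ j → f i * g (j ∸ i) ≡ 0ℚ
  term-vanishes i i≤j with i ℕ.<? p
  ... | yes i<p = trans (cong (_* g (j ∸ i)) (f≈0 i i<p)) (*-zeroˡ (g (j ∸ i)))
  ... | no  i≮p = trans (cong (f i *_) (g≈0 (j ∸ i) j-i<q)) (*-zeroʳ (f i))
    where
    j-i<q : j ∸ i < q
    j-i<q = ℕ.≤-<-trans (ℕ.∸-monoʳ-≤ j (ℕ.≮⇒≥ i≮p))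
              (subst (j ∸ p <_) (ℕ.m+n∸m≡n p q) (ℕ.∸-monoˡ-< j<p+q (ℕ.≤-trans (ℕ.≮⇒≥ i≮p) i≤j)))

pow-≈[]-0ₛ : ∀ b → b 0 ≡ 0ℚ → ∀ k → pow b k ≈[ k ] 0ₛ
pow-≈[]-0ₛ b b₀≡0 zero    j ()
pow-≈[]-0ₛ b b₀≡0 (suc k) = ⊛-≈[]-0ₛ {b} 1 k (λ { zero _ → b₀≡0 ; (suc j) (s≤s ()) }) (pow-≈[]-0ₛ b b₀≡0 k)

LiPartial : ℕ → PS → ℕ → PS
LiPartial d b zero    = cst 0ℚ
LiPartial d b (suc M) = LiPartial d b M ⊕ cst (invPow d M) ⊛ pow b (suc M)

LiPartial-θ : ∀ d b M → b ⊛ θ (LiPartial (suc d) b M) ≈ LiPartial d b M ⊛ θ b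
LiPartial-θ d b zero = begin
  b ⊛ θ (cst 0ℚ)  ≈⟨ ⊛-congˡ b (θ-cst 0ℚ) ⟩
  b ⊛ cst 0ℚ      ≈⟨ solve 2 (λ b t → b :* con 0ℚ := con 0ℚ :* t) ≈-refl b (θ b) ⟩
  cst 0ℚ ⊛ θ b    ∎
  where open PS-Reasoning
LiPartial-θ d b (suc M) = begin
  b ⊛ θ (P′ ⊕ c′ ⊛ (b ⊛ bᴹ))
    ≈⟨ ⊛-congˡ b (≈-trans (θ-⊕ P′ (c′ ⊛ (b ⊛ bᴹ))) (⊕-congˡ (θ P′) θ-term)) ⟩
  b ⊛ (θ P′ ⊕ c′ ⊛ (k ⊛ bᴹ ⊛ θ b))
    ≈⟨ solve 6 (λ b t q c k p → b :* (q :+ c :* (k :* p :* t)) := b :* q :+ k :* c :* (b :* p) :* t)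
               ≈-refl b (θ b) (θ P′) c′ k bᴹ ⟩
  b ⊛ θ P′ ⊕ k ⊛ c′ ⊛ (b ⊛ bᴹ) ⊛ θ b
    ≈⟨ +-cong (LiPartial-θ d b M) (⊛-congʳ (θ b) (⊛-congʳ (b ⊛ bᴹ) k⊛c′≈c)) ⟩
  P ⊛ θ b ⊕ c ⊛ (b ⊛ bᴹ) ⊛ θ b
    ≈⟨ solve 4 (λ p c q t → p :* t :+ c :* q :* t := (p :+ c :* q) :* t) ≈-refl P c (b ⊛ bᴹ) (θ b) ⟩
  (P ⊕ c ⊛ (b ⊛ bᴹ)) ⊛ θ b ∎
  where
  open PS-Reasoning
  P′ = LiPartial (suc d) b M
  P  = LiPartial d b M
  bᴹ = pow b M
  k  = cst (ℕ→ℚ (suc M))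
  c′ = cst (invPow (suc d) M)
  c  = cst (invPow d M)
  θ-term : θ (c′ ⊛ (b ⊛ bᴹ)) ≈ c′ ⊛ (k ⊛ bᴹ ⊛ θ b)
  θ-term = ≈-trans (θ-cst-⊛ (invPow (suc d) M) (b ⊛ bᴹ)) (⊛-congˡ c′ (θ-pow b M))
  k⊛c′≈c : k ⊛ c′ ≈ c
  k⊛c′≈c n = trans (sym (cst-* (ℕ→ℚ (suc M)) (invPow (suc d) M) n)) (cong (λ a → cst a n) (ℕ→ℚ-*-invPow d M))

LiPartial-geometric : ∀ b M → (cst 1ℚ ⊖ b) ⊛ LiPartial 0 b M ≈ b ⊖ pow b (suc M)
LiPartial-geometric b zero = solve 1 (λ b → (con 1ℚ :- b) :* con 0ℚ := b :- b :* con 1ℚ) ≈-refl b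
  where open PS-Reasoning
LiPartial-geometric b (suc M) = begin
  (cst 1ℚ ⊖ b) ⊛ (P ⊕ cst 1ℚ ⊛ (b ⊛ bᴹ))
    ≈⟨ solve 3 (λ b p q → (con 1ℚ :- b) :* (p :+ con 1ℚ :* q) := (con 1ℚ :- b) :* p :+ (con 1ℚ :- b) :* q)
               ≈-refl b P (b ⊛ bᴹ) ⟩
  (cst 1ℚ ⊖ b) ⊛ P ⊕ (cst 1ℚ ⊖ b) ⊛ (b ⊛ bᴹ)
    ≈⟨ ⊕-congʳ ((cst 1ℚ ⊖ b) ⊛ (b ⊛ bᴹ)) (LiPartial-geometric b M) ⟩
  b ⊖ b ⊛ bᴹ ⊕ (cst 1ℚ ⊖ b) ⊛ (b ⊛ bᴹ)
    ≈⟨ solve 2 (λ b q → b :- q :+ (con 1ℚ :- b) :* q := b :- b :* q) ≈-refl b (b ⊛ bᴹ) ⟩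
  b ⊖ b ⊛ (b ⊛ bᴹ) ∎
  where
  open PS-Reasoning
  P  = LiPartial 0 b M
  bᴹ = pow b M

LiPartial-coefficient : ∀ d b M j {F : ℕ → ℚ} → (∀ m → F (suc m) ≡ invPow d m * pow b (suc m) j) →
                        LiPartial d b M j ≡ sum1To M F
LiPartial-coefficient d b zero    zero    F-suc = refl
LiPartial-coefficient d b zero    (suc j) F-suc = refl
LiPartial-coefficient d b (suc M) j       F-suc =
  cong₂ _+_ (LiPartial-coefficient d b M j F-suc) (trans (cst-⊛ (invPow d M) (pow b (suc M)) j) (sym (F-suc M)))

-- `_` is the summand in the definition of Li, a local function that cannot be named here.
Li≈[]LiPartial : ∀ b → b 0 ≡ 0ℚ → ∀ d M → Li d b ≈[ suc M ] LiPartial d b M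
Li≈[]LiPartial b b₀≡0 d M j (s≤s j≤M) = sym (begin
  LiPartial d b M j  ≡⟨ LiPartial-coefficient d b M j (λ _ → refl) ⟩
  sum1To M _         ≡⟨ sum1To-extend j M j≤M high-terms-vanish ⟩
  Li d b j           ∎)
  where
  open ≡-Reasoning
  high-terms-vanish : ∀ m → j ≤ m → invPow d m * pow b (suc m) j ≡ 0ℚ
  high-terms-vanish m j≤m = trans (cong (invPow d m *_) (pow-≈[]-0ₛ b b₀≡0 (suc m) j (s≤s j≤m))) (*-zeroʳ (invPow d m))

Li-θ : ∀ b → b 0 ≡ 0ℚ → ∀ d → b ⊛ θ (Li (suc d) b) ≈ Li d b ⊛ θ b
Li-θ b b₀≡0 d n = agree n ℕ.≤-refl
  where
  open Relation.Binary.Reasoning.Setoid (≈[]-setoid (suc n))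
  agree : b ⊛ θ (Li (suc d) b) ≈[ suc n ] Li d b ⊛ θ b
  agree = begin
    b ⊛ θ (Li (suc d) b)
      ≈⟨ ⊛-cong-≈[] (suc n) (≈[]-refl b) (θ-cong-≈[] (suc n) (Li≈[]LiPartial b b₀≡0 (suc d) n)) ⟩
    b ⊛ θ (LiPartial (suc d) b n)
      ≈⟨ ≈⇒≈[] (suc n) (LiPartial-θ d b n) ⟩
    LiPartial d b n ⊛ θ b
      ≈⟨ ⊛-cong-≈[] (suc n) (Li≈[]LiPartial b b₀≡0 d n) (≈[]-refl (θ b)) ⟨
    Li d b ⊛ θ b ∎

Li₀-geometric : ∀ b → b 0 ≡ 0ℚ → (cst 1ℚ ⊖ b) ⊛ Li 0 b ≈ b
Li₀-geometric b b₀≡0 n = agree n ℕ.≤-refl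
  where
  open Relation.Binary.Reasoning.Setoid (≈[]-setoid (suc n))
  agree : (cst 1ℚ ⊖ b) ⊛ Li 0 b ≈[ suc n ] b
  agree = begin
    (cst 1ℚ ⊖ b) ⊛ Li 0 b
      ≈⟨ ⊛-cong-≈[] (suc n) (≈[]-refl (cst 1ℚ ⊖ b)) (Li≈[]LiPartial b b₀≡0 0 n) ⟩
    (cst 1ℚ ⊖ b) ⊛ LiPartial 0 b n
      ≈⟨ ≈⇒≈[] (suc n) (LiPartial-geometric b n) ⟩
    b ⊖ pow b (suc n)
      ≈⟨ (λ j j<1+n → cong₂ _+_ (refl {x = b j}) (cong -_ (pow-≈[]-0ₛ b b₀≡0 (suc n) j j<1+n))) ⟩
    b ⊖ 0ₛ
      ≈⟨ (λ j _ → +-identityʳ (b j)) ⟩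
    b ∎

-- Central binomial coefficients

[2n]Cn*[n!*n!]≡[2n]! : ∀ n → ((2 ℕ.* n) C n) ℕ.* (n ! ℕ.* n !) ≡ (2 ℕ.* n) !
[2n]Cn*[n!*n!]≡[2n]! n = begin
  ((2 ℕ.* n) C n) ℕ.* (n ! ℕ.* n !)  ≡⟨ cong (λ m → ((2 ℕ.* n) C n) ℕ.* (n ! ℕ.* m !)) 2n∸n≡n ⟨
  ((2 ℕ.* n) C n) ℕ.* d              ≡⟨ cong (ℕ._* d) (nCk≡n!/k![n-k]! n≤2n) ⟩
  (2 ℕ.* n) ! ℕ./ d ℕ.* d            ≡⟨ m/n*n≡m (k![n∸k]!∣n! n≤2n) ⟩
  (2 ℕ.* n) !                        ∎
  where
  open ≡-Reasoning
  d = n ! ℕ.* (2 ℕ.* n ∸ n) !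
  instance _ = n !* (2 ℕ.* n ∸ n) !≢0
  n≤2n : n ≤ 2 ℕ.* n
  n≤2n = ℕ.m≤m+n n (n ℕ.+ 0)
  2n∸n≡n : 2 ℕ.* n ∸ n ≡ n
  2n∸n≡n = trans (cong (λ m → n ℕ.+ m ∸ n) (ℕ.+-identityʳ n)) (ℕ.m+n∸m≡n n n)

[n+1]*[2n+2]C[n+1]≡[4n+2]*[2n]Cn : ∀ n → suc n ℕ.* ((2 ℕ.* suc n) C suc n) ≡ (4 ℕ.* n ℕ.+ 2) ℕ.* ((2 ℕ.* n) C n)
[n+1]*[2n+2]C[n+1]≡[4n+2]*[2n]Cn n = ℕ.*-cancelʳ-≡ _ _ (suc n ℕ.* (n ! ℕ.* n !)) {{nonZero}} (begin
  suc n ℕ.* c₁ ℕ.* (suc n ℕ.* (n ! ℕ.* n !))            ≡⟨ regroup (suc n) c₁ (n !) ⟩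
  c₁ ℕ.* (suc n ! ℕ.* suc n !)                          ≡⟨ [2n]Cn*[n!*n!]≡[2n]! (suc n) ⟩
  (2 ℕ.* suc n) !                                       ≡⟨ cong _! (2[1+n]≡2+2n n) ⟩
  suc (suc m) ℕ.* (suc m ℕ.* m !)                       ≡⟨ cong (λ z → suc (suc m) ℕ.* (suc m ℕ.* z)) central ⟨
  suc (suc m) ℕ.* (suc m ℕ.* (c₀ ℕ.* (n ! ℕ.* n !)))    ≡⟨ expand n c₀ (n !) ⟩
  (4 ℕ.* n ℕ.+ 2) ℕ.* c₀ ℕ.* (suc n ℕ.* (n ! ℕ.* n !))  ∎)
  where
  open ≡-Reasoning
  m  = 2 ℕ.* n
  central = [2n]Cn*[n!*n!]≡[2n]! n
  c₀ = (2 ℕ.* n) C n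
  c₁ = (2 ℕ.* suc n) C suc n
  nonZero : ℕ.NonZero (suc n ℕ.* (n ! ℕ.* n !))
  nonZero = ℕ.m*n≢0 (suc n) (n ! ℕ.* n !) {{_}} {{n !* n !≢0}}
  regroup : ∀ m c f → m ℕ.* c ℕ.* (m ℕ.* (f ℕ.* f)) ≡ c ℕ.* ((m ℕ.* f) ℕ.* (m ℕ.* f))
  regroup = ℕ-Solver.solve-∀
  2[1+n]≡2+2n : ∀ n → 2 ℕ.* suc n ≡ suc (suc (2 ℕ.* n))
  2[1+n]≡2+2n = ℕ-Solver.solve-∀
  expand : ∀ n c f → suc (suc (2 ℕ.* n)) ℕ.* (suc (2 ℕ.* n) ℕ.* (c ℕ.* (f ℕ.* f)))
                     ≡ (4 ℕ.* n ℕ.+ 2) ℕ.* c ℕ.* (suc n ℕ.* (f ℕ.* f))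
  expand = ℕ-Solver.solve-∀

centralBinomial : PS
centralBinomial n = ℕ→ℚ ((2 ℕ.* n) C n)

centralBinomial-recurrence : ∀ n → ℕ→ℚ (suc n) * centralBinomial (suc n)
                                 ≡ (4ℚ * ℕ→ℚ n + 2ℚ) * centralBinomial n
centralBinomial-recurrence n = begin
  ℕ→ℚ (suc n) * ℕ→ℚ c₁          ≡⟨ ℕ→ℚ-* (suc n) c₁ ⟨
  ℕ→ℚ (suc n ℕ.* c₁)            ≡⟨ cong ℕ→ℚ ([n+1]*[2n+2]C[n+1]≡[4n+2]*[2n]Cn n) ⟩
  ℕ→ℚ ((4 ℕ.* n ℕ.+ 2) ℕ.* c₀)  ≡⟨ ℕ→ℚ-* (4 ℕ.* n ℕ.+ 2) c₀ ⟩
  ℕ→ℚ (4 ℕ.* n ℕ.+ 2) * ℕ→ℚ c₀  ≡⟨ cong (_* ℕ→ℚ c₀) 4n+2 ⟩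
  (4ℚ * ℕ→ℚ n + 2ℚ) * ℕ→ℚ c₀    ∎
  where
  open ≡-Reasoning
  c₀ = (2 ℕ.* n) C n
  c₁ = (2 ℕ.* suc n) C suc n
  4n+2 : ℕ→ℚ (4 ℕ.* n ℕ.+ 2) ≡ 4ℚ * ℕ→ℚ n + 2ℚ
  4n+2 = trans (ℕ→ℚ-+ (4 ℕ.* n) 2) (cong (_+ 2ℚ) (ℕ→ℚ-* 4 n))

oneMinus4X : PS
oneMinus4X = cst 1ℚ ⊖ cst 4ℚ ⊛ X

-- D annihilates Σ binom(2n,n) xⁿ = (1 − 4x)^(−1/2).
D : PS → PS
D f = oneMinus4X ⊛ θ f ⊖ cst 2ℚ ⊛ X ⊛ f

D-coefficient : ∀ f n → D f (suc n) ≡ ℕ→ℚ (suc n) * f (suc n) - (4ℚ * ℕ→ℚ n + 2ℚ) * f n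
D-coefficient f n = begin
  D f (suc n)                                        ≡⟨ shift (suc n) ⟩
  ℕ→ℚ (suc n) * f (suc n) - (X ⊛ g) (suc n)          ≡⟨ cong (λ z → θ f (suc n) - z) (X-⊛-suc g n) ⟩
  ℕ→ℚ (suc n) * f (suc n) - g n                      ≡⟨ cong (λ z → θ f (suc n) - z) g-coefficient ⟩
  ℕ→ℚ (suc n) * f (suc n) - (4ℚ * ℕ→ℚ n + 2ℚ) * f n  ∎
  where
  open ≡-Reasoning
  g = cst 4ℚ ⊛ θ f ⊕ cst 2ℚ ⊛ f
  shift : D f ≈ θ f ⊖ X ⊛ g
  shift = solve 3 (λ x t f → (con 1ℚ :- con 4ℚ :* x) :* t :- con 2ℚ :* x :* f
                             := t :- x :* (con 4ℚ :* t :+ con 2ℚ :* f)) ≈-refl X (θ f) f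
    where open PS-Reasoning
  factor : ∀ a m b y → a * (m * y) + b * y ≡ (a * m + b) * y
  factor = solve 4 (λ a m b y → a :* (m :* y) :+ b :* y := (a :* m :+ b) :* y) refl
    where open +-*-Solver
  g-coefficient : g n ≡ (4ℚ * ℕ→ℚ n + 2ℚ) * f n
  g-coefficient = trans (cong₂ _+_ (cst-⊛ _ (θ f) n) (cst-⊛ _ f n)) (factor 4ℚ (ℕ→ℚ n) 2ℚ (f n))

D-injective : ∀ {f g} → D f ≈ D g → f 0 ≡ g 0 → f ≈ g
D-injective {f} {g} Df≈Dg f₀≡g₀ = agree
  where
  open ≡-Reasoning
  agree : f ≈ g
  agree zero    = f₀≡g₀
  agree (suc n) = ℕ→ℚ-suc-cancelˡ n (∙-cancelʳ (- (r * g n)) _ _ (begin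
    ℕ→ℚ (suc n) * f (suc n) - r * g n  ≡⟨ cong (λ z → ℕ→ℚ (suc n) * f (suc n) - r * z) (agree n) ⟨
    ℕ→ℚ (suc n) * f (suc n) - r * f n  ≡⟨ D-coefficient f n ⟨
    D f (suc n)                        ≡⟨ Df≈Dg (suc n) ⟩
    D g (suc n)                        ≡⟨ D-coefficient g n ⟩
    ℕ→ℚ (suc n) * g (suc n) - r * g n  ∎))
    where
    r = 4ℚ * ℕ→ℚ n + 2ℚ

D-centralBinomial : D centralBinomial ≈ cst 0ℚ
D-centralBinomial zero    = refl
D-centralBinomial (suc n) = begin
  D centralBinomial (suc n)                       ≡⟨ D-coefficient centralBinomial n ⟩
  ℕ→ℚ (suc n) * centralBinomial (suc n) - r * c₀  ≡⟨ cong (_- r * c₀) (centralBinomial-recurrence n) ⟩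
  r * c₀ - r * c₀                                 ≡⟨ +-inverseʳ (r * c₀) ⟩
  0ℚ                                              ∎
  where
  open ≡-Reasoning
  r  = 4ℚ * ℕ→ℚ n + 2ℚ
  c₀ = centralBinomial n

oneMinus4X-⊛-θ : ∀ f → oneMinus4X ⊛ θ f ≈ D f ⊕ cst 2ℚ ⊛ X ⊛ f
oneMinus4X-⊛-θ f = solve 4 (λ s t x f → s :* t := (s :* t :- con 2ℚ :* x :* f) :+ con 2ℚ :* x :* f)
                           ≈-refl oneMinus4X (θ f) X f
  where open PS-Reasoning

oneMinus4X-⊛-θ-centralBinomial : oneMinus4X ⊛ θ centralBinomial ≈ cst 2ℚ ⊛ X ⊛ centralBinomial
oneMinus4X-⊛-θ-centralBinomial = begin
  oneMinus4X ⊛ θ B         ≈⟨ oneMinus4X-⊛-θ B ⟩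
  D B ⊕ cst 2ℚ ⊛ X ⊛ B     ≈⟨ ⊕-congʳ (cst 2ℚ ⊛ X ⊛ B) D-centralBinomial ⟩
  cst 0ℚ ⊕ cst 2ℚ ⊛ X ⊛ B  ≈⟨ solve 1 (λ y → con 0ℚ :+ y := y) ≈-refl (cst 2ℚ ⊛ X ⊛ B) ⟩
  cst 2ℚ ⊛ X ⊛ B           ∎
  where
  open PS-Reasoning
  B = centralBinomial

θ-oneMinus4X : θ oneMinus4X ≈ ⊝ (cst 4ℚ ⊛ X)
θ-oneMinus4X = ≈-trans (θ-cst-⊖ 1ℚ (cst 4ℚ ⊛ X)) (⊝-cong (≈-trans (θ-cst-⊛ 4ℚ X) (⊛-congˡ (cst 4ℚ) θ-X)))

oneMinus4X-⊛-centralBinomial² : oneMinus4X ⊛ centralBinomial ⊛ centralBinomial ≈ cst 1ℚ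
oneMinus4X-⊛-centralBinomial² = θ-injective θ-equation refl
  where
  open PS-Reasoning
  B = centralBinomial
  s = oneMinus4X
  θ-equation : θ (s ⊛ B ⊛ B) ≈ θ (cst 1ℚ)
  θ-equation = begin
    θ (s ⊛ B ⊛ B)
      ≈⟨ θ-⊛₃ s B B ⟩
    θ s ⊛ B ⊛ B ⊕ s ⊛ θ B ⊛ B ⊕ s ⊛ B ⊛ θ B
      ≈⟨ solve 4 (λ s′ s b t → s′ :* b :* b :+ s :* t :* b :+ s :* b :* t := s′ :* b :* b :+ con 2ℚ :* b :* (s :* t))
                 ≈-refl (θ s) s B (θ B) ⟩
    θ s ⊛ B ⊛ B ⊕ cst 2ℚ ⊛ B ⊛ (s ⊛ θ B)
      ≈⟨ +-cong (⊛-congʳ B (⊛-congʳ B θ-oneMinus4X)) (⊛-congˡ (cst 2ℚ ⊛ B) oneMinus4X-⊛-θ-centralBinomial) ⟩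
    ⊝ (cst 4ℚ ⊛ X) ⊛ B ⊛ B ⊕ cst 2ℚ ⊛ B ⊛ (cst 2ℚ ⊛ X ⊛ B)
      ≈⟨ solve 2 (λ x b → :- (con 4ℚ :* x) :* b :* b :+ con 2ℚ :* b :* (con 2ℚ :* x :* b) := con 0ℚ)
                 ≈-refl X B ⟩
    cst 0ℚ
      ≈⟨ θ-cst 1ℚ ⟨
    θ (cst 1ℚ) ∎

-- The Catalan series β

θ-β : θ β ≈ X ⊛ centralBinomial
θ-β zero    = refl
θ-β (suc k) = trans (ℕ→ℚ-*-catalan k) (sym (X-⊛-suc centralBinomial k))

oneMinus2β-⊛ : oneMinus2β ≈ cst 1ℚ ⊖ cst 2ℚ ⊛ β
oneMinus2β-⊛ = ⊕-congˡ (cst 1ℚ) (⊝-cong (≈-sym (cst-⊛ 2ℚ β)))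

θ-oneMinus2β : θ oneMinus2β ≈ ⊝ (cst 2ℚ ⊛ (X ⊛ centralBinomial))
θ-oneMinus2β = begin
  θ oneMinus2β                        ≈⟨ θ-cst-⊖ 1ℚ (2ℚ · β) ⟩
  ⊝ θ (2ℚ · β)                        ≈⟨ ⊝-cong (θ-· 2ℚ β) ⟩
  ⊝ (2ℚ · θ β)                        ≈⟨ ⊝-cong (cst-⊛ 2ℚ (θ β)) ⟨
  ⊝ (cst 2ℚ ⊛ θ β)                    ≈⟨ ⊝-cong (⊛-congˡ (cst 2ℚ) θ-β) ⟩
  ⊝ (cst 2ℚ ⊛ (X ⊛ centralBinomial))  ∎
  where open PS-Reasoning

-- B (1 − 2β) and 1 have the same constant term and both satisfy D y = −2x.
centralBinomial-⊛-oneMinus2β : centralBinomial ⊛ oneMinus2β ≈ cst 1ℚ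
centralBinomial-⊛-oneMinus2β = D-injective (≈-trans D-Bu (≈-sym D-1)) refl
  where
  open PS-Reasoning
  B = centralBinomial
  u = oneMinus2β
  s = oneMinus4X
  D-1 : D (cst 1ℚ) ≈ ⊝ (cst 2ℚ ⊛ X)
  D-1 = begin
    s ⊛ θ (cst 1ℚ) ⊖ cst 2ℚ ⊛ X ⊛ cst 1ℚ  ≈⟨ ⊕-congʳ (⊝ (cst 2ℚ ⊛ X ⊛ cst 1ℚ)) (⊛-congˡ s (θ-cst 1ℚ)) ⟩
    s ⊛ cst 0ℚ ⊖ cst 2ℚ ⊛ X ⊛ cst 1ℚ      ≈⟨ solve 2 (λ s x → s :* con 0ℚ :- con 2ℚ :* x :* con 1ℚ := :- (con 2ℚ :* x))
                                                           ≈-refl s X ⟩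
    ⊝ (cst 2ℚ ⊛ X)                        ∎
  D-Bu : D (B ⊛ u) ≈ ⊝ (cst 2ℚ ⊛ X)
  D-Bu = begin
    s ⊛ θ (B ⊛ u) ⊖ cst 2ℚ ⊛ X ⊛ (B ⊛ u)
      ≈⟨ ⊕-congʳ (⊝ (cst 2ℚ ⊛ X ⊛ (B ⊛ u))) (⊛-congˡ s (≈-trans (θ-⊛ B u) (⊕-congˡ (θ B ⊛ u) (⊛-congˡ B θ-oneMinus2β)))) ⟩
    s ⊛ (θ B ⊛ u ⊕ B ⊛ ⊝ (cst 2ℚ ⊛ (X ⊛ B))) ⊖ cst 2ℚ ⊛ X ⊛ (B ⊛ u)
      ≈⟨ solve 5 (λ s t u b x → s :* (t :* u :+ b :* :- (con 2ℚ :* (x :* b))) :- con 2ℚ :* x :* (b :* u)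
                               := s :* t :* u :- con 2ℚ :* x :* (s :* b :* b) :- con 2ℚ :* x :* (b :* u))
                 ≈-refl s (θ B) u B X ⟩
    s ⊛ θ B ⊛ u ⊖ cst 2ℚ ⊛ X ⊛ (s ⊛ B ⊛ B) ⊖ cst 2ℚ ⊛ X ⊛ (B ⊛ u)
      ≈⟨ ⊕-congʳ (⊝ (cst 2ℚ ⊛ X ⊛ (B ⊛ u)))
                 (⊖-cong (⊛-congʳ u oneMinus4X-⊛-θ-centralBinomial) (⊛-congˡ (cst 2ℚ ⊛ X) oneMinus4X-⊛-centralBinomial²)) ⟩
    cst 2ℚ ⊛ X ⊛ B ⊛ u ⊖ cst 2ℚ ⊛ X ⊛ cst 1ℚ ⊖ cst 2ℚ ⊛ X ⊛ (B ⊛ u)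
      ≈⟨ solve 3 (λ x b u → con 2ℚ :* x :* b :* u :- con 2ℚ :* x :* con 1ℚ :- con 2ℚ :* x :* (b :* u)
                             := :- (con 2ℚ :* x))
                 ≈-refl X B u ⟩
    ⊝ (cst 2ℚ ⊛ X)                        ∎

oneMinus4X-⊛-centralBinomial : oneMinus4X ⊛ centralBinomial ≈ oneMinus2β
oneMinus4X-⊛-centralBinomial = begin
  s ⊛ B            ≈⟨ solve 2 (λ s b → s :* b := s :* b :* con 1ℚ) ≈-refl s B ⟩
  s ⊛ B ⊛ cst 1ℚ   ≈⟨ ⊛-congˡ (s ⊛ B) centralBinomial-⊛-oneMinus2β ⟨
  s ⊛ B ⊛ (B ⊛ u)  ≈⟨ solve 3 (λ s b u → s :* b :* (b :* u) := s :* b :* b :* u) ≈-refl s B u ⟩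
  s ⊛ B ⊛ B ⊛ u    ≈⟨ ⊛-congʳ u oneMinus4X-⊛-centralBinomial² ⟩
  cst 1ℚ ⊛ u       ≈⟨ ⊛-identityˡ u ⟩
  u                ∎
  where
  open PS-Reasoning
  B = centralBinomial
  u = oneMinus2β
  s = oneMinus4X

β-⊛-oneMinusβ : β ⊛ (cst 1ℚ ⊖ β) ≈ X
β-⊛-oneMinusβ = θ-injective θ-equation refl
  where
  open PS-Reasoning
  B = centralBinomial
  θ-equation : θ (β ⊛ (cst 1ℚ ⊖ β)) ≈ θ X
  θ-equation = begin
    θ (β ⊛ (cst 1ℚ ⊖ β))                     ≈⟨ θ-⊛ β (cst 1ℚ ⊖ β) ⟩
    θ β ⊛ (cst 1ℚ ⊖ β) ⊕ β ⊛ θ (cst 1ℚ ⊖ β)  ≈⟨ ⊕-congˡ (θ β ⊛ (cst 1ℚ ⊖ β)) (⊛-congˡ β (θ-cst-⊖ 1ℚ β)) ⟩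
    θ β ⊛ (cst 1ℚ ⊖ β) ⊕ β ⊛ ⊝ θ β           ≈⟨ solve 2 (λ t b → t :* (con 1ℚ :- b) :+ b :* :- t := t :* (con 1ℚ :- con 2ℚ :* b))
                                                         ≈-refl (θ β) β ⟩
    θ β ⊛ (cst 1ℚ ⊖ cst 2ℚ ⊛ β)              ≈⟨ ⊛-cong θ-β (≈-sym oneMinus2β-⊛) ⟩
    X ⊛ B ⊛ oneMinus2β                       ≈⟨ solve 3 (λ x b u → x :* b :* u := x :* (b :* u)) ≈-refl X B oneMinus2β ⟩
    X ⊛ (B ⊛ oneMinus2β)                     ≈⟨ ⊛-congˡ X centralBinomial-⊛-oneMinus2β ⟩
    X ⊛ cst 1ℚ                               ≈⟨ solve 1 (λ x → x :* con 1ℚ := x) ≈-refl X ⟩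
    X                                        ≈⟨ θ-X ⟨
    θ X                                      ∎

β-⊛-θ-cancel : ∀ g h → β ⊛ θ g ≈ h ⊛ θ β → θ g ≈ (cst 1ℚ ⊖ β) ⊛ h ⊛ centralBinomial
β-⊛-θ-cancel g h βθg≈hθβ = X-cancel (begin
  X ⊛ θ g                       ≈⟨ ⊛-congʳ (θ g) β-⊛-oneMinusβ ⟨
  β ⊛ (cst 1ℚ ⊖ β) ⊛ θ g        ≈⟨ solve 3 (λ b v t → b :* v :* t := v :* (b :* t)) ≈-refl β (cst 1ℚ ⊖ β) (θ g) ⟩
  (cst 1ℚ ⊖ β) ⊛ (β ⊛ θ g)      ≈⟨ ⊛-congˡ (cst 1ℚ ⊖ β) (≈-trans βθg≈hθβ (⊛-congˡ h θ-β)) ⟩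
  (cst 1ℚ ⊖ β) ⊛ (h ⊛ (X ⊛ B))  ≈⟨ solve 4 (λ v h x b → v :* (h :* (x :* b)) := x :* (v :* h :* b)) ≈-refl (cst 1ℚ ⊖ β) h X B ⟩
  X ⊛ ((cst 1ℚ ⊖ β) ⊛ h ⊛ B)    ∎)
  where
  open PS-Reasoning
  B = centralBinomial

θ-Li₁β : θ (Li 1 β) ≈ β ⊛ centralBinomial
θ-Li₁β = ≈-trans (β-⊛-θ-cancel (Li 1 β) (Li 0 β) (Li-θ β refl 0)) (⊛-congʳ centralBinomial (Li₀-geometric β refl))

θ-Li₂β : θ (Li 2 β) ≈ (cst 1ℚ ⊖ β) ⊛ Li 1 β ⊛ centralBinomial
θ-Li₂β = β-⊛-θ-cancel (Li 2 β) (Li 1 β) (Li-θ β refl 1)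

-- The harmonic series

centralBinomialOverN : PS
centralBinomialOverN zero    = 0ℚ
centralBinomialOverN (suc n) = centralBinomial (suc n) * invPow 1 n

D-lhs₁ : D lhs₁ ≈ centralBinomialOverN
D-lhs₁ zero    = refl
D-lhs₁ (suc n) = begin
  D lhs₁ (suc n)                                 ≡⟨ D-coefficient lhs₁ n ⟩
  x * (c₁ * (h + invPow 2 n)) - r * (c₀ * h)     ≡⟨ regroup x c₁ h (invPow 2 n) r c₀ ⟩
  (x * c₁ - r * c₀) * h + c₁ * (x * invPow 2 n)  ≡⟨ cong₂ (λ u v → u * h + c₁ * v) recurrence (ℕ→ℚ-*-invPow 1 n) ⟩
  0ℚ * h + c₁ * invPow 1 n                       ≡⟨ cong (_+ c₁ * invPow 1 n) (*-zeroˡ h) ⟩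
  0ℚ + c₁ * invPow 1 n                           ≡⟨ +-identityˡ _ ⟩
  c₁ * invPow 1 n                                ∎
  where
  open ≡-Reasoning
  x  = ℕ→ℚ (suc n)
  r  = 4ℚ * ℕ→ℚ n + 2ℚ
  h  = H 2 n
  c₀ = centralBinomial n
  c₁ = centralBinomial (suc n)
  regroup : ∀ x c₁ h i r c₀ → x * (c₁ * (h + i)) - r * (c₀ * h) ≡ (x * c₁ - r * c₀) * h + c₁ * (x * i)
  regroup = solve 6 (λ x c₁ h i r c₀ → x :* (c₁ :* (h :+ i)) :- r :* (c₀ :* h)
                                     := (x :* c₁ :- r :* c₀) :* h :+ c₁ :* (x :* i)) refl
    where open +-*-Solver
  recurrence : x * c₁ - r * c₀ ≡ 0ℚ
  recurrence = trans (cong (_- r * c₀) (centralBinomial-recurrence n)) (+-inverseʳ (r * c₀))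

θ-centralBinomialOverN : θ centralBinomialOverN ≈ centralBinomial ⊖ cst 1ℚ
θ-centralBinomialOverN zero    = refl
θ-centralBinomialOverN (suc n) = begin
  ℕ→ℚ (suc n) * (c₁ * invPow 1 n)  ≡⟨ x∙yz≈y∙xz (ℕ→ℚ (suc n)) c₁ (invPow 1 n) ⟩
  c₁ * (ℕ→ℚ (suc n) * invPow 1 n)  ≡⟨ cong (c₁ *_) (ℕ→ℚ-*-invPow 0 n) ⟩
  c₁ * 1ℚ                          ≡⟨ *-identityʳ c₁ ⟩
  c₁                               ≡⟨ +-identityʳ c₁ ⟨
  c₁ - 0ℚ                          ∎
  where
  open ≡-Reasoning
  c₁ = centralBinomial (suc n)

centralBinomialOverN≈2Li₁β : centralBinomialOverN ≈ cst 2ℚ ⊛ Li 1 β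
centralBinomialOverN≈2Li₁β = θ-injective θ-equation refl
  where
  open PS-Reasoning
  B = centralBinomial
  θ-equation : θ centralBinomialOverN ≈ θ (cst 2ℚ ⊛ Li 1 β)
  θ-equation = begin
    θ centralBinomialOverN         ≈⟨ θ-centralBinomialOverN ⟩
    B ⊖ cst 1ℚ                     ≈⟨ ⊕-congˡ B (⊝-cong centralBinomial-⊛-oneMinus2β) ⟨
    B ⊖ B ⊛ oneMinus2β             ≈⟨ ⊕-congˡ B (⊝-cong (⊛-congˡ B oneMinus2β-⊛)) ⟩
    B ⊖ B ⊛ (cst 1ℚ ⊖ cst 2ℚ ⊛ β)  ≈⟨ solve 2 (λ b β → b :- b :* (con 1ℚ :- con 2ℚ :* β) := con 2ℚ :* (β :* b)) ≈-refl B β ⟩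
    cst 2ℚ ⊛ (β ⊛ B)               ≈⟨ ⊛-congˡ (cst 2ℚ) θ-Li₁β ⟨
    cst 2ℚ ⊛ θ (Li 1 β)            ≈⟨ θ-cst-⊛ 2ℚ (Li 1 β) ⟨
    θ (cst 2ℚ ⊛ Li 1 β)            ∎

θ-lhs₂ : θ lhs₂ ≈ X ⊛ lhs₁
θ-lhs₂ zero    = refl
θ-lhs₂ (suc k) = begin
  ℕ→ℚ (suc k) * (catalan k * H 2 k)  ≡⟨ *-assoc (ℕ→ℚ (suc k)) (catalan k) (H 2 k) ⟨
  ℕ→ℚ (suc k) * catalan k * H 2 k    ≡⟨ cong (_* H 2 k) (ℕ→ℚ-*-catalan k) ⟩
  lhs₁ k                             ≡⟨ X-⊛-suc lhs₁ k ⟨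
  (X ⊛ lhs₁) (suc k)                 ∎
  where open ≡-Reasoning

θ-rhs₁num : θ rhs₁num ≈ centralBinomial ⊛ (cst 2ℚ ⊛ Li 1 β)
θ-rhs₁num = begin
  θ (2ℚ · L₂ ⊕ L₁ ⊛ L₁)
    ≈⟨ θ-⊕ (2ℚ · L₂) (L₁ ⊛ L₁) ⟩
  θ (2ℚ · L₂) ⊕ θ (L₁ ⊛ L₁)
    ≈⟨ +-cong (≈-trans (θ-· 2ℚ L₂) (≈-sym (cst-⊛ 2ℚ (θ L₂)))) (θ-⊛ L₁ L₁) ⟩
  cst 2ℚ ⊛ θ L₂ ⊕ (θ L₁ ⊛ L₁ ⊕ L₁ ⊛ θ L₁)
    ≈⟨ +-cong (⊛-congˡ (cst 2ℚ) θ-Li₂β) (+-cong (⊛-congʳ L₁ θ-Li₁β) (⊛-congˡ L₁ θ-Li₁β)) ⟩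
  cst 2ℚ ⊛ ((cst 1ℚ ⊖ β) ⊛ L₁ ⊛ B) ⊕ (β ⊛ B ⊛ L₁ ⊕ L₁ ⊛ (β ⊛ B))
    ≈⟨ solve 3 (λ β l b → con 2ℚ :* ((con 1ℚ :- β) :* l :* b) :+ (β :* b :* l :+ l :* (β :* b)) := b :* (con 2ℚ :* l))
               ≈-refl β L₁ B ⟩
  B ⊛ (cst 2ℚ ⊛ L₁) ∎
  where
  open PS-Reasoning
  B  = centralBinomial
  L₁ = Li 1 β
  L₂ = Li 2 β

lhs₁⊛oneMinus2β≈rhs₁num : lhs₁ ⊛ oneMinus2β ≈ rhs₁num
lhs₁⊛oneMinus2β≈rhs₁num = θ-injective θ-equation refl
  where
  open PS-Reasoning
  B = centralBinomial
  f = lhs₁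
  u = oneMinus2β
  θ-equation : θ (f ⊛ u) ≈ θ rhs₁num
  θ-equation = begin
    θ (f ⊛ u)
      ≈⟨ θ-⊛ f u ⟩
    θ f ⊛ u ⊕ f ⊛ θ u
      ≈⟨ +-cong (⊛-congˡ (θ f) (≈-sym oneMinus4X-⊛-centralBinomial)) (⊛-congˡ f θ-oneMinus2β) ⟩
    θ f ⊛ (oneMinus4X ⊛ B) ⊕ f ⊛ ⊝ (cst 2ℚ ⊛ (X ⊛ B))
      ≈⟨ solve 5 (λ t s b f x → t :* (s :* b) :+ f :* :- (con 2ℚ :* (x :* b)) := b :* (s :* t :- con 2ℚ :* x :* f))
                 ≈-refl (θ f) oneMinus4X B f X ⟩
    B ⊛ D f
      ≈⟨ ⊛-congˡ B (≈-trans D-lhs₁ centralBinomialOverN≈2Li₁β) ⟩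
    B ⊛ (cst 2ℚ ⊛ Li 1 β)
      ≈⟨ θ-rhs₁num ⟨
    θ rhs₁num ∎

lhs₁≈centralBinomial⊛rhs₁num : lhs₁ ≈ centralBinomial ⊛ rhs₁num
lhs₁≈centralBinomial⊛rhs₁num = begin
  lhs₁                     ≈⟨ solve 1 (λ f → f := f :* con 1ℚ) ≈-refl lhs₁ ⟩
  lhs₁ ⊛ cst 1ℚ            ≈⟨ ⊛-congˡ lhs₁ centralBinomial-⊛-oneMinus2β ⟨
  lhs₁ ⊛ (B ⊛ oneMinus2β)  ≈⟨ solve 3 (λ f b u → f :* (b :* u) := b :* (f :* u)) ≈-refl lhs₁ B oneMinus2β ⟩
  B ⊛ (lhs₁ ⊛ oneMinus2β)  ≈⟨ ⊛-congˡ B lhs₁⊛oneMinus2β≈rhs₁num ⟩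
  B ⊛ rhs₁num              ∎
  where
  open PS-Reasoning
  B = centralBinomial

θ-rhs₂ : θ rhs₂ ≈ X ⊛ (centralBinomial ⊛ rhs₁num)
θ-rhs₂ = begin
  θ (2ℚ · (β ⊛ L₂) ⊖ v ⊛ (L₁ ⊛ L₁))
    ≈⟨ θ-⊖ (2ℚ · (β ⊛ L₂)) (v ⊛ (L₁ ⊛ L₁)) ⟩
  θ (2ℚ · (β ⊛ L₂)) ⊖ θ (v ⊛ (L₁ ⊛ L₁))
    ≈⟨ ⊖-cong (≈-trans (θ-· 2ℚ (β ⊛ L₂)) (≈-sym (cst-⊛ 2ℚ (θ (β ⊛ L₂))))) (θ-⊛ v (L₁ ⊛ L₁)) ⟩
  cst 2ℚ ⊛ θ (β ⊛ L₂) ⊖ (θ v ⊛ (L₁ ⊛ L₁) ⊕ v ⊛ θ (L₁ ⊛ L₁))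
    ≈⟨ ⊖-cong (⊛-congˡ (cst 2ℚ) θ-β⊛L₂) (+-cong (⊛-congʳ (L₁ ⊛ L₁) θ-v) (⊛-congˡ v θ-L₁⊛L₁)) ⟩
  cst 2ℚ ⊛ (X ⊛ B ⊛ L₂ ⊕ β ⊛ (v ⊛ L₁ ⊛ B)) ⊖ (⊝ (X ⊛ B) ⊛ (L₁ ⊛ L₁) ⊕ v ⊛ (β ⊛ B ⊛ L₁ ⊕ L₁ ⊛ (β ⊛ B)))
    ≈⟨ solve 5 (λ x b β l₁ l₂ →
                  con 2ℚ :* (x :* b :* l₂ :+ β :* ((con 1ℚ :- β) :* l₁ :* b))
                    :- (:- (x :* b) :* (l₁ :* l₁) :+ (con 1ℚ :- β) :* (β :* b :* l₁ :+ l₁ :* (β :* b)))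
                  := x :* (b :* (con 2ℚ :* l₂ :+ l₁ :* l₁)))
               ≈-refl X B β L₁ L₂ ⟩
  X ⊛ (B ⊛ (cst 2ℚ ⊛ L₂ ⊕ L₁ ⊛ L₁))
    ≈⟨ ⊛-congˡ X (⊛-congˡ B (⊕-congʳ (L₁ ⊛ L₁) (cst-⊛ 2ℚ L₂))) ⟩
  X ⊛ (B ⊛ rhs₁num) ∎
  where
  open PS-Reasoning
  B  = centralBinomial
  L₁ = Li 1 β
  L₂ = Li 2 β
  v  = cst 1ℚ ⊖ β
  θ-v : θ v ≈ ⊝ (X ⊛ B)
  θ-v = ≈-trans (θ-cst-⊖ 1ℚ β) (⊝-cong θ-β)
  θ-β⊛L₂ : θ (β ⊛ L₂) ≈ X ⊛ B ⊛ L₂ ⊕ β ⊛ (v ⊛ L₁ ⊛ B)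
  θ-β⊛L₂ = ≈-trans (θ-⊛ β L₂) (+-cong (⊛-congʳ L₂ θ-β) (⊛-congˡ β θ-Li₂β))
  θ-L₁⊛L₁ : θ (L₁ ⊛ L₁) ≈ β ⊛ B ⊛ L₁ ⊕ L₁ ⊛ (β ⊛ B)
  θ-L₁⊛L₁ = ≈-trans (θ-⊛ L₁ L₁) (+-cong (⊛-congʳ L₁ θ-Li₁β) (⊛-congˡ L₁ θ-Li₁β))

lhs₂≈rhs₂ : lhs₂ ≈ rhs₂
lhs₂≈rhs₂ = θ-injective θ-equation refl
  where
  θ-equation : θ lhs₂ ≈ θ rhs₂
  θ-equation = ≈-trans θ-lhs₂ (≈-trans (⊛-congˡ X lhs₁≈centralBinomial⊛rhs₁num) (≈-sym θ-rhs₂))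

theorem5p1 : ((n : _) → (lhs₁ ⊛ oneMinus2β) n ≡ rhs₁num n)
           × ((n : _) → lhs₂ n ≡ rhs₂ n)
theorem5p1 = lhs₁⊛oneMinus2β≈rhs₁num , lhs₂≈rhs₂
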